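{- For cycle $\mathbb{C}_n,$ $$TDI(\mathbb{C}_n)=\begin{cases} \frac{n^2}{2} \quad &\text{ if } n\equiv 0 (mod4)\\ \frac{n(n+1)}{2} \quad &\text{ if } n\equiv 1,3 (mod 4)\\ \frac{n^2}{2}+n \quad &\text{ if } n\equiv 2 (mod 4) \end{cases}$$
   Context: $n\ge 3$. A total dominating set (TDS) is a vertex set $S$ such that every vertex is adjacent to a vertex of $S$; a minimal TDS (MTDS) has no proper subset that is a TDS. $d_{td}(a)=\min\{|S| : S \text{ an MTDS containing } a\}$ and $TDI(\mathbb{G})=\sum_{a\in V(\mathbb{G})} d_{td}(a)$ (the cycle is compliant, i.e., every vertex lies in some MTDS). -}

module Defs where

open import Data.Nat using (ℕ; zero; suc; _≤_)
open import Data.Fin using (Fin; toℕ)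
open import Data.Fin.Subset using (Subset; _∈_; _⊂_; ∣_∣)
open import Data.List using (List; map; allFin)
open import Data.Nat.ListAction using (sum)
open import Data.Product using (Σ; _×_; ∃)
open import Data.Sum using (_⊎_)
open import Data.Empty using (⊥)
open import Relation.Binary.PropositionalEquality using (_≡_)

CycSucc : (n : ℕ) → Fin n → Fin n → Set
CycSucc n i j = (suc (toℕ i) ≡ toℕ j) ⊎ ((suc (toℕ i) ≡ n) × (toℕ j ≡ 0))

Adj : (n : ℕ) → Fin n → Fin n → Set
Adj n i j = CycSucc n i j ⊎ CycSucc n j i

IsTDS : (n : ℕ) → Subset n → Set
IsTDS n S = ∀ (v : Fin n) → Σ (Fin n) (λ u → (u ∈ S) × Adj n v u)

IsMTDS : (n : ℕ) → Subset n → Set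
IsMTDS n S = IsTDS n S × (∀ (T : Subset n) → T ⊂ S → IsTDS n T → ⊥)

IsDtd : (n : ℕ) → Fin n → ℕ → Set
IsDtd n a k =
  Σ (Subset n) (λ S → IsMTDS n S × (a ∈ S) × (∣ S ∣ ≡ k))
  × (∀ (S : Subset n) → IsMTDS n S → a ∈ S → k ≤ ∣ S ∣)

-- TDI(C_n) = t : there is the function a ↦ d_td(a) (which is unique) and its sum is t
IsTDI : (n : ℕ) → ℕ → Set
IsTDI n t = Σ (Fin n → ℕ) (λ d → (∀ a → IsDtd n a (d a)) × (sum (map d (allFin n)) ≡ t))

-- A vertex set S of C_n, read as an n-periodic 0/1 sequence, is a total dominating set iff it
-- meets every pair {j, j + 2} (the neighbourhood of j + 1). Double counting then gives
-- 2|S| ≥ n, and for n = 2m the even and odd positions separately meet every pair {j, j + 1} of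
-- a cycle of length m, giving |S| ≥ 2⌈m/2⌉. The rotations of the pattern 1100 1100 … attain
-- these bounds, and one of them passes through any given vertex; being a minimum TDS it is
-- minimal. Hence d_td(a) = γ_t(C_n) for every vertex a and TDI(C_n) = n γ_t(C_n), with
-- γ_t(C_n) = ⌈n/2⌉, except n/2 + 1 when n ≡ 2 (mod 4).

module Submission where

open import Defs
open import Data.Nat using (ℕ; _≤_; _*_; _+_)
open import Data.Nat.DivMod using (_%_; _/_)
open import Data.Product using (_×_)
open import Data.Sum using (_⊎_)
open import Relation.Binary.PropositionalEquality using (_≡_)

open import Data.Bool using (Bool; true; false; if_then_else_)
open import Data.Empty using (⊥; ⊥-elim)
open import Data.Fin as Fin using (Fin; toℕ)
open import Data.Fin.Properties using (toℕ<n; toℕ-fromℕ<; toℕ-injective)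
open import Data.Fin.Subset using (Subset; _∈_; _⊂_; ∣_∣)
open import Data.Fin.Subset.Properties using (p⊂q⇒∣p∣<∣q∣)
open import Data.List using (List; map; length; allFin)
open import Data.List.Properties using (length-tabulate)
open import Data.Nat using (zero; suc; pred; _<_; _∸_; z≤n; s≤s; NonZero; >-nonZero; ⌈_/2⌉; _<?_)
open import Data.Nat.DivMod using (_mod_; m≡m%n+[m/n]*n; m<n⇒m%n≡m; m%n<n; m%n≤m; n%n≡0; [m+n]%n≡m%n; m%n%n≡m%n; %-distribˡ-+; %-remove-+ˡ; m≤n⇒[n∸m]%m≡n%m; m*n/n≡m)
open import Data.Nat.Divisibility using (∣-refl)
open import Data.Nat.ListAction using (sum)
open import Data.Nat.Properties
open import Data.Product using (Σ-syntax; _,_; proj₁)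
open import Data.Sum as Sum using (inj₁; inj₂)
open import Data.Vec using ([]; _∷_; lookup; tabulate)
open import Data.Vec.Properties using (lookup∘tabulate; []=⇒lookup; lookup⇒[]=)
open import Function using (id; _∘_)
open import Relation.Binary.PropositionalEquality using (refl; sym; trans; cong; cong₂; subst; module ≡-Reasoning)
open import Relation.Nullary using (yes; no)
open import Algebra.Properties.CommutativeSemigroup +-commutativeSemigroup using (interchange)

count : (ℕ → Bool) → ℕ → ℕ
count A zero    = 0
count A (suc m) = (if A 0 then 1 else 0) + count (A ∘ suc) m

Periodic : ℕ → (ℕ → Bool) → Set
Periodic p A = ∀ i → A (p + i) ≡ A i

MeetsPairs : ℕ → (ℕ → Bool) → Set
MeetsPairs k A = ∀ j → A j ≡ true ⊎ A (k + j) ≡ true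

count-cong : ∀ m {A B : ℕ → Bool} → (∀ x → x < m → A x ≡ B x) → count A m ≡ count B m
count-cong zero    A≗B = refl
count-cong (suc m) A≗B = cong₂ (λ b c → (if b then 1 else 0) + c)
  (A≗B 0 (s≤s z≤n)) (count-cong m (λ x x<m → A≗B (suc x) (s≤s x<m)))

count-+ : ∀ m k A → count A (m + k) ≡ count A m + count (λ x → A (m + x)) k
count-+ zero    k A = refl
count-+ (suc m) k A = trans (cong (a₀ +_) (count-+ m k (A ∘ suc))) (sym (+-assoc a₀ _ _))
  where a₀ = if A 0 then 1 else 0

count-rotate : ∀ m c {A} → Periodic m A → count (λ x → A (c + x)) m ≡ count A m
count-rotate m c {A} periodic = +-cancelˡ-≡ (count A c) _ _ (begin
  count A c + count (λ x → A (c + x)) m  ≡⟨ count-+ c m A ⟨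
  count A (c + m)                        ≡⟨ cong (count A) (+-comm c m) ⟩
  count A (m + c)                        ≡⟨ count-+ m c A ⟩
  count A m + count (λ x → A (m + x)) c  ≡⟨ cong (count A m +_) (count-cong c (λ x _ → periodic x)) ⟩
  count A m + count A c                  ≡⟨ +-comm (count A m) (count A c) ⟩
  count A c + count A m                  ∎)
  where open ≡-Reasoning

count-cover : ∀ m (A B : ℕ → Bool) → (∀ j → A j ≡ true ⊎ B j ≡ true) → m ≤ count A m + count B m
count-cover zero    A B cover = z≤n
count-cover (suc m) A B cover with A 0 | B 0 | cover 0 | count-cover m (A ∘ suc) (B ∘ suc) (cover ∘ suc)
... | true  | b₀    | _        | ih = s≤s (≤-trans ih (+-monoʳ-≤ (count (A ∘ suc) m) (m≤n+m _ (if b₀ then 1 else 0))))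
... | false | true  | _        | ih = subst (suc m ≤_) (sym (+-suc (count (A ∘ suc) m) _)) (s≤s ih)
... | false | false | inj₁ ()  | _
... | false | false | inj₂ ()  | _

count-evens-odds : ∀ m A → count A (m * 2) ≡ count (λ j → A (j * 2)) m + count (λ j → A (suc (j * 2))) m
count-evens-odds zero    A = refl
count-evens-odds (suc m) A = begin
  a₀ + (a₁ + count (A ∘ suc ∘ suc) (m * 2))  ≡⟨ cong (λ c → a₀ + (a₁ + c)) (count-evens-odds m (A ∘ suc ∘ suc)) ⟩
  a₀ + (a₁ + (evens + odds))                 ≡⟨ +-assoc a₀ a₁ _ ⟨
  (a₀ + a₁) + (evens + odds)                 ≡⟨ interchange a₀ a₁ evens odds ⟩
  (a₀ + evens) + (a₁ + odds)                 ∎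
  where
  open ≡-Reasoning
  a₀ a₁ evens odds : ℕ
  a₀    = if A 0 then 1 else 0
  a₁    = if A 1 then 1 else 0
  evens = count (λ j → A (suc (suc (j * 2)))) m
  odds  = count (λ j → A (suc (suc (suc (j * 2))))) m

periodic-rotate : ∀ {p A} c → Periodic p A → Periodic p (λ x → A (x + c))
periodic-rotate {p} {A} c periodic i = trans (cong A (+-assoc p i c)) (periodic (i + c))

meetsPairs-rotate : ∀ {k A} c → MeetsPairs k A → MeetsPairs k (λ x → A (x + c))
meetsPairs-rotate {k} {A} c meets j = Sum.map₂ (trans (cong A (+-assoc k j c))) (meets (j + c))

meetsPairs-≗ : ∀ {k A B} → (∀ x → A x ≡ B x) → MeetsPairs k A → MeetsPairs k B
meetsPairs-≗ {k} A≗B meets j = Sum.map (trans (sym (A≗B j))) (trans (sym (A≗B (k + j)))) (meets j)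

⌈m/2⌉≤count : ∀ m k {A} → Periodic m A → MeetsPairs k A → ⌈ m /2⌉ ≤ count A m
⌈m/2⌉≤count m k {A} periodic meets =
  subst (⌈ m /2⌉ ≤_) (sym (n≡⌈n+n/2⌉ (count A m))) (⌈n/2⌉-mono m≤count+count)
  where
  m≤count+count : m ≤ count A m + count A m
  m≤count+count = subst (λ c → m ≤ count A m + c) (count-rotate m k periodic)
    (count-cover m A (λ j → A (k + j)) meets)

⌈m/2⌉*2≤count : ∀ m {A} → Periodic (m * 2) A → MeetsPairs 2 A → ⌈ m /2⌉ * 2 ≤ count A (m * 2)
⌈m/2⌉*2≤count m {A} periodic meets = begin
  ⌈ m /2⌉ * 2                  ≡⟨ *-suc ⌈ m /2⌉ 1 ⟩
  ⌈ m /2⌉ + ⌈ m /2⌉ * 1        ≡⟨ cong (⌈ m /2⌉ +_) (*-identityʳ ⌈ m /2⌉) ⟩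
  ⌈ m /2⌉ + ⌈ m /2⌉            ≤⟨ +-mono-≤ (⌈m/2⌉≤count m 1 evens-periodic (meets ∘ (_* 2)))
                                          (⌈m/2⌉≤count m 1 odds-periodic (meets ∘ suc ∘ (_* 2))) ⟩
  count evens m + count odds m ≡⟨ count-evens-odds m A ⟨
  count A (m * 2)              ∎
  where
  open ≤-Reasoning
  evens odds : ℕ → Bool
  evens j = A (j * 2)
  odds  j = A (suc (j * 2))
  evens-periodic : Periodic m evens
  evens-periodic j = trans (cong A (*-distribʳ-+ 2 m j)) (periodic (j * 2))
  odds-periodic : Periodic m odds
  odds-periodic j = trans (cong A (trans (cong suc (*-distribʳ-+ 2 m j)) (sym (+-suc (m * 2) (j * 2)))))
                          (periodic (suc (j * 2)))

twoOnTwoOff : ℕ → Bool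
twoOnTwoOff 0                         = true
twoOnTwoOff 1                         = true
twoOnTwoOff 2                         = false
twoOnTwoOff 3                         = false
twoOnTwoOff (suc (suc (suc (suc i)))) = twoOnTwoOff i

twoOnTwoOff-meetsPairs : MeetsPairs 2 twoOnTwoOff
twoOnTwoOff-meetsPairs 0                         = inj₁ refl
twoOnTwoOff-meetsPairs 1                         = inj₁ refl
twoOnTwoOff-meetsPairs 2                         = inj₂ refl
twoOnTwoOff-meetsPairs 3                         = inj₂ refl
twoOnTwoOff-meetsPairs (suc (suc (suc (suc j)))) = twoOnTwoOff-meetsPairs j

twoOnTwoOff-≤1 : ∀ {x} → x ≤ 1 → twoOnTwoOff x ≡ true
twoOnTwoOff-≤1 z≤n       = refl
twoOnTwoOff-≤1 (s≤s z≤n) = refl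

count-twoOnTwoOff-odd : ∀ m → count twoOnTwoOff (suc (m * 2)) ≡ suc m
count-twoOnTwoOff-odd 0             = refl
count-twoOnTwoOff-odd 1             = refl
count-twoOnTwoOff-odd (suc (suc m)) = cong (2 +_) (count-twoOnTwoOff-odd m)

count-twoOnTwoOff-even : ∀ m → count twoOnTwoOff (m * 2) ≡ ⌈ m /2⌉ * 2
count-twoOnTwoOff-even 0             = refl
count-twoOnTwoOff-even 1             = refl
count-twoOnTwoOff-even (suc (suc m)) = cong (2 +_) (count-twoOnTwoOff-even m)

⌈m*2/2⌉≡m : ∀ m → ⌈ m * 2 /2⌉ ≡ m
⌈m*2/2⌉≡m zero    = refl
⌈m*2/2⌉≡m (suc m) = cong suc (⌈m*2/2⌉≡m m)

⌈1+m*2/2⌉≡1+m : ∀ m → ⌈ suc (m * 2) /2⌉ ≡ suc m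
⌈1+m*2/2⌉≡1+m zero    = refl
⌈1+m*2/2⌉≡1+m (suc m) = cong suc (⌈1+m*2/2⌉≡1+m m)

[m+n%d]%d≡[m+n]%d : ∀ m n d .{{_ : NonZero d}} → (m + n % d) % d ≡ (m + n) % d
[m+n%d]%d≡[m+n]%d m n d = begin
  (m + n % d) % d         ≡⟨ %-distribˡ-+ m (n % d) d ⟩
  (m % d + n % d % d) % d ≡⟨ cong (λ r → (m % d + r) % d) (m%n%n≡m%n n d) ⟩
  (m % d + n % d) % d     ≡⟨ %-distribˡ-+ m n d ⟨
  (m + n) % d             ∎
  where open ≡-Reasoning

periodic-+* : ∀ {p A} → Periodic p A → ∀ k x → A (k * p + x) ≡ A x
periodic-+* {p} {A} periodic zero    x = refl
periodic-+* {p} {A} periodic (suc k) x =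
  trans (cong A (+-assoc p (k * p) x)) (trans (periodic (k * p + x)) (periodic-+* periodic k x))

periodic-% : ∀ {p A} .{{_ : NonZero p}} → Periodic p A → ∀ x → A (x % p) ≡ A x
periodic-% {p} {A} periodic x = begin
  A (x % p)             ≡⟨ periodic-+* periodic (x / p) (x % p) ⟨
  A (x / p * p + x % p) ≡⟨ cong A (+-comm (x / p * p) (x % p)) ⟩
  A (x % p + x / p * p) ≡⟨ cong A (m≡m%n+[m/n]*n x p) ⟨
  A x                   ∎
  where open ≡-Reasoning

count-lookup : ∀ {n} (S : Subset n) (A : ℕ → Bool) → (∀ i → lookup S i ≡ A (toℕ i)) → ∣ S ∣ ≡ count A n
count-lookup []          A S≗A = refl
count-lookup (true ∷ S)  A S≗A rewrite sym (S≗A Fin.zero) = cong suc (count-lookup S (A ∘ suc) (S≗A ∘ Fin.suc))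
count-lookup (false ∷ S) A S≗A rewrite sym (S≗A Fin.zero) = count-lookup S (A ∘ suc) (S≗A ∘ Fin.suc)

∣tabulate∣≡count : ∀ n (A : ℕ → Bool) → ∣ tabulate {n = n} (A ∘ toℕ) ∣ ≡ count A n
∣tabulate∣≡count n A = count-lookup {n} (tabulate (A ∘ toℕ)) A (lookup∘tabulate (A ∘ toℕ))

sum-map-const : ∀ {A : Set} γ (xs : List A) → sum (map (λ _ → γ) xs) ≡ length xs * γ
sum-map-const γ List.[]       = refl
sum-map-const γ (x List.∷ xs) = cong (γ +_) (sum-map-const γ xs)

isTDI-of-minimum : ∀ n γ → (∀ S → IsTDS n S → γ ≤ ∣ S ∣) →
                   (∀ a → Σ[ S ∈ Subset n ] IsTDS n S × a ∈ S × ∣ S ∣ ≡ γ) →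
                   IsTDI n (n * γ)
isTDI-of-minimum n γ lower witness = (λ _ → γ) , isDtd , total
  where
  isDtd : ∀ a → IsDtd n a γ
  isDtd a with witness a
  ... | S , tds , a∈S , ∣S∣≡γ = (S , (tds , minimal) , a∈S , ∣S∣≡γ) , λ T mtds _ → lower T (proj₁ mtds)
    where
    minimal : ∀ T → T ⊂ S → IsTDS n T → ⊥
    minimal T T⊂S tds-T = <⇒≱ (p⊂q⇒∣p∣<∣q∣ T⊂S) (subst (_≤ ∣ T ∣) (sym ∣S∣≡γ) (lower T tds-T))
  total : sum (map (λ _ → γ) (allFin n)) ≡ n * γ
  total = trans (sum-map-const γ (allFin n)) (cong (_* γ) (length-tabulate {n = n} id))

cycSucc-functional : ∀ {n} {i j k : Fin n} → CycSucc n i j → CycSucc n i k → j ≡ k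
cycSucc-functional         (inj₁ i→j)         (inj₁ i→k)         = toℕ-injective (trans (sym i→j) i→k)
cycSucc-functional {j = j} (inj₁ i→j)         (inj₂ (i+1≡n , _)) = ⊥-elim (<-irrefl (trans (sym i→j) i+1≡n) (toℕ<n j))
cycSucc-functional {k = k} (inj₂ (i+1≡n , _)) (inj₁ i→k)         = ⊥-elim (<-irrefl (trans (sym i→k) i+1≡n) (toℕ<n k))
cycSucc-functional         (inj₂ (_ , j≡0))   (inj₂ (_ , k≡0))   = toℕ-injective (trans j≡0 (sym k≡0))

cycSucc-injective : ∀ {n} {i j k : Fin n} → CycSucc n i k → CycSucc n j k → i ≡ j
cycSucc-injective (inj₁ i→k)         (inj₁ j→k)         = toℕ-injective (suc-injective (trans i→k (sym j→k)))
cycSucc-injective (inj₁ i→k)         (inj₂ (_ , k≡0))   = ⊥-elim (1+n≢0 (trans i→k k≡0))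
cycSucc-injective (inj₂ (_ , k≡0))   (inj₁ j→k)         = ⊥-elim (1+n≢0 (trans j→k k≡0))
cycSucc-injective (inj₂ (i+1≡n , _)) (inj₂ (j+1≡n , _)) = toℕ-injective (suc-injective (trans i+1≡n (sym j+1≡n)))

module _ (n : ℕ) .{{_ : NonZero n}} where

  toℕ-mod : ∀ x → toℕ (x mod n) ≡ x % n
  toℕ-mod x = toℕ-fromℕ< (m%n<n x n)

  mod-cong : ∀ {x y} → x % n ≡ y % n → x mod n ≡ y mod n
  mod-cong {x} {y} eq = toℕ-injective (trans (toℕ-mod x) (trans eq (sym (toℕ-mod y))))

  toℕ-mod-inverse : ∀ (i : Fin n) → toℕ i mod n ≡ i
  toℕ-mod-inverse i = toℕ-injective (trans (toℕ-mod (toℕ i)) (m<n⇒m%n≡m (toℕ<n i)))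

  cycSucc-mod : ∀ x → CycSucc n (x mod n) (suc x mod n)
  cycSucc-mod x with m≤n⇒m<n∨m≡n (m%n<n x n)
  ... | inj₁ 1+x%n<n = inj₁ (begin
    suc (toℕ (x mod n)) ≡⟨ cong suc (toℕ-mod x) ⟩
    suc (x % n)         ≡⟨ m<n⇒m%n≡m 1+x%n<n ⟨
    suc (x % n) % n     ≡⟨ [m+n%d]%d≡[m+n]%d 1 x n ⟩
    suc x % n           ≡⟨ toℕ-mod (suc x) ⟨
    toℕ (suc x mod n)   ∎)
    where open ≡-Reasoning
  ... | inj₂ 1+x%n≡n = inj₂ (trans (cong suc (toℕ-mod x)) 1+x%n≡n , (begin
    toℕ (suc x mod n) ≡⟨ toℕ-mod (suc x) ⟩
    suc x % n         ≡⟨ [m+n%d]%d≡[m+n]%d 1 x n ⟨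
    suc (x % n) % n   ≡⟨ cong (_% n) 1+x%n≡n ⟩
    n % n             ≡⟨ n%n≡0 n ⟩
    0                 ∎))
    where open ≡-Reasoning

  indicator : Subset n → ℕ → Bool
  indicator S x = lookup S (x mod n)

  indicator-periodic : ∀ S → Periodic n (indicator S)
  indicator-periodic S i = cong (lookup S) (mod-cong (%-remove-+ˡ i ∣-refl))

  ∣S∣≡count-indicator : ∀ S → ∣ S ∣ ≡ count (indicator S) n
  ∣S∣≡count-indicator S = count-lookup S (indicator S) (λ i → cong (lookup S) (sym (toℕ-mod-inverse i)))

  isTDS⇒meetsPairs : ∀ S → IsTDS n S → MeetsPairs 2 (indicator S)
  isTDS⇒meetsPairs S tds v with tds (suc v mod n)
  ... | u , u∈S , inj₁ w→u = inj₂ ([]=⇒lookup (subst (_∈ S) (cycSucc-functional w→u (cycSucc-mod (suc v))) u∈S))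
  ... | u , u∈S , inj₂ u→w = inj₁ ([]=⇒lookup (subst (_∈ S) (cycSucc-injective u→w (cycSucc-mod v)) u∈S))

  meetsPairs⇒isTDS : ∀ S → MeetsPairs 2 (indicator S) → IsTDS n S
  meetsPairs⇒isTDS S meets w = subst (λ w → Σ[ u ∈ Fin n ] u ∈ S × Adj n w u) suc-v≡w (neighbour (meets v))
    where
    v : ℕ
    v = toℕ w + pred n
    suc-v≡w+n : suc v ≡ toℕ w + n
    suc-v≡w+n = trans (sym (+-suc (toℕ w) (pred n))) (cong (toℕ w +_) (suc-pred n))
    suc-v≡w : suc v mod n ≡ w
    suc-v≡w = trans (mod-cong (trans (cong (_% n) suc-v≡w+n) ([m+n]%n≡m%n (toℕ w) n))) (toℕ-mod-inverse w)
    neighbour : indicator S v ≡ true ⊎ indicator S (2 + v) ≡ true → Σ[ u ∈ Fin n ] u ∈ S × Adj n (suc v mod n) u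
    neighbour (inj₁ v∈S)   = v mod n , lookup⇒[]= _ S v∈S , inj₂ (cycSucc-mod v)
    neighbour (inj₂ 2+v∈S) = (2 + v) mod n , lookup⇒[]= _ S 2+v∈S , inj₁ (cycSucc-mod (suc v))

  periodic-bound⇒TDS-bound : ∀ {b} → (∀ {A} → Periodic n A → MeetsPairs 2 A → b ≤ count A n) →
                             ∀ S → IsTDS n S → b ≤ ∣ S ∣
  periodic-bound⇒TDS-bound {b} bound S tds =
    subst (b ≤_) (sym (∣S∣≡count-indicator S)) (bound (indicator-periodic S) (isTDS⇒meetsPairs S tds))

  indicator-tabulate : ∀ {A} → Periodic n A → ∀ x → indicator (tabulate (A ∘ toℕ)) x ≡ A x
  indicator-tabulate {A} periodic x =
    trans (lookup∘tabulate (A ∘ toℕ) (x mod n)) (trans (cong A (toℕ-mod x)) (periodic-% periodic x))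

  cyclicTwoOnTwoOff : ℕ → Bool
  cyclicTwoOnTwoOff x = twoOnTwoOff (x % n)

  cyclicTwoOnTwoOff-periodic : Periodic n cyclicTwoOnTwoOff
  cyclicTwoOnTwoOff-periodic i = cong twoOnTwoOff (%-remove-+ˡ i ∣-refl)

  cyclicTwoOnTwoOff-meetsPairs : MeetsPairs 2 cyclicTwoOnTwoOff
  cyclicTwoOnTwoOff-meetsPairs x with twoOnTwoOff-meetsPairs (x % n)
  ... | inj₁ hit = inj₁ hit
  ... | inj₂ hit = inj₂ (trans (cong twoOnTwoOff (sym ([m+n%d]%d≡[m+n]%d 2 x n))) (wrap (m%n<n x n) hit))
    where
    -- 2 + y wraps around only for the last two positions y, and then lands on 0 or 1.
    wrap : ∀ {y} → y < n → twoOnTwoOff (2 + y) ≡ true → twoOnTwoOff ((2 + y) % n) ≡ true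
    wrap {y} y<n hit with 2 + y <? n
    ... | yes 2+y<n = trans (cong twoOnTwoOff (m<n⇒m%n≡m 2+y<n)) hit
    ... | no  2+y≮n = twoOnTwoOff-≤1 (begin
      (2 + y) % n     ≡⟨ m≤n⇒[n∸m]%m≡n%m (≮⇒≥ 2+y≮n) ⟨
      (2 + y ∸ n) % n ≤⟨ m%n≤m (2 + y ∸ n) n ⟩
      2 + y ∸ n       ≤⟨ ∸-monoʳ-≤ (2 + y) y<n ⟩
      2 + y ∸ suc y   ≡⟨ m+n∸n≡m 1 y ⟩
      1               ∎)
      where open ≤-Reasoning

  rotation : Fin n → ℕ → Bool
  rotation a x = cyclicTwoOnTwoOff (x + (n ∸ toℕ a))

  minimumTDS : Fin n → Subset n
  minimumTDS a = tabulate (rotation a ∘ toℕ)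

  minimumTDS-isTDS : ∀ a → IsTDS n (minimumTDS a)
  minimumTDS-isTDS a = meetsPairs⇒isTDS (minimumTDS a)
    (meetsPairs-≗ (λ x → sym (indicator-tabulate rotation-periodic x))
                  (meetsPairs-rotate (n ∸ toℕ a) cyclicTwoOnTwoOff-meetsPairs))
    where
    rotation-periodic : Periodic n (rotation a)
    rotation-periodic = periodic-rotate (n ∸ toℕ a) cyclicTwoOnTwoOff-periodic

  ∈-minimumTDS : ∀ a → a ∈ minimumTDS a
  ∈-minimumTDS a = lookup⇒[]= a (minimumTDS a) (begin
    lookup (minimumTDS a) a                  ≡⟨ lookup∘tabulate (rotation a ∘ toℕ) a ⟩
    twoOnTwoOff ((toℕ a + (n ∸ toℕ a)) % n)  ≡⟨ cong (λ x → twoOnTwoOff (x % n)) (m+[n∸m]≡n (<⇒≤ (toℕ<n a))) ⟩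
    twoOnTwoOff (n % n)                      ≡⟨ cong twoOnTwoOff (n%n≡0 n) ⟩
    true                                     ∎)
    where open ≡-Reasoning

  ∣minimumTDS∣ : ∀ a → ∣ minimumTDS a ∣ ≡ count twoOnTwoOff n
  ∣minimumTDS∣ a = begin
    ∣ minimumTDS a ∣                          ≡⟨ ∣tabulate∣≡count n (rotation a) ⟩
    count (λ x → cyclicTwoOnTwoOff (x + c)) n ≡⟨ count-cong n (λ x _ → cong cyclicTwoOnTwoOff (+-comm x c)) ⟩
    count (λ x → cyclicTwoOnTwoOff (c + x)) n ≡⟨ count-rotate n c cyclicTwoOnTwoOff-periodic ⟩
    count cyclicTwoOnTwoOff n                 ≡⟨ count-cong n (λ x x<n → cong twoOnTwoOff (m<n⇒m%n≡m x<n)) ⟩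
    count twoOnTwoOff n                       ∎
    where
    open ≡-Reasoning
    c : ℕ
    c = n ∸ toℕ a

data Parity : ℕ → Set where
  even : ∀ m → Parity (m * 2)
  odd  : ∀ m → Parity (suc (m * 2))

parity : ∀ n → Parity n
parity zero = even zero
parity (suc n) with parity n
... | even m = odd m
... | odd  m = even (suc m)

count-twoOnTwoOff≤∣TDS∣ : ∀ n .{{_ : NonZero n}} S → IsTDS n S → count twoOnTwoOff n ≤ ∣ S ∣
count-twoOnTwoOff≤∣TDS∣ n S tds with parity n
... | even m = begin
  count twoOnTwoOff (m * 2) ≡⟨ count-twoOnTwoOff-even m ⟩
  ⌈ m /2⌉ * 2               ≤⟨ periodic-bound⇒TDS-bound (m * 2) (⌈m/2⌉*2≤count m) S tds ⟩
  ∣ S ∣                     ∎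
  where open ≤-Reasoning
... | odd m = begin
  count twoOnTwoOff (suc (m * 2)) ≡⟨ count-twoOnTwoOff-odd m ⟩
  suc m                           ≡⟨ ⌈1+m*2/2⌉≡1+m m ⟨
  ⌈ suc (m * 2) /2⌉               ≤⟨ periodic-bound⇒TDS-bound (suc (m * 2)) (⌈m/2⌉≤count _ 2) S tds ⟩
  ∣ S ∣                           ∎
  where open ≤-Reasoning

isTDI-cycle : ∀ n .{{_ : NonZero n}} → IsTDI n (n * count twoOnTwoOff n)
isTDI-cycle n = isTDI-of-minimum n _ (count-twoOnTwoOff≤∣TDS∣ n)
  (λ a → minimumTDS n a , minimumTDS-isTDS n a , ∈-minimumTDS n a , ∣minimumTDS∣ n a)

n*[m*2]/2≡n*m : ∀ n m → n * (m * 2) / 2 ≡ n * m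
n*[m*2]/2≡n*m n m = trans (cong (_/ 2) (sym (*-assoc n m 2))) (m*n/n≡m (n * m) 2)

n*count-odd : ∀ m → suc (m * 2) * count twoOnTwoOff (suc (m * 2)) ≡ suc (m * 2) * (suc (m * 2) + 1) / 2
n*count-odd m = begin
  n * count twoOnTwoOff n ≡⟨ cong (n *_) (count-twoOnTwoOff-odd m) ⟩
  n * suc m               ≡⟨ n*[m*2]/2≡n*m n (suc m) ⟨
  n * (suc m * 2) / 2     ≡⟨ cong (λ x → n * x / 2) (+-comm 1 n) ⟩
  n * (n + 1) / 2         ∎
  where
  open ≡-Reasoning
  n : ℕ
  n = suc (m * 2)

n*count-4k : ∀ k → k * 2 * 2 * count twoOnTwoOff (k * 2 * 2) ≡ k * 2 * 2 * (k * 2 * 2) / 2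
n*count-4k k = begin
  n * count twoOnTwoOff n  ≡⟨ cong (n *_) (count-twoOnTwoOff-even (k * 2)) ⟩
  n * (⌈ k * 2 /2⌉ * 2)    ≡⟨ cong (λ c → n * (c * 2)) (⌈m*2/2⌉≡m k) ⟩
  n * (k * 2)              ≡⟨ n*[m*2]/2≡n*m n (k * 2) ⟨
  n * n / 2                ∎
  where
  open ≡-Reasoning
  n : ℕ
  n = k * 2 * 2

n*count-4k+2 : ∀ k → suc (k * 2) * 2 * count twoOnTwoOff (suc (k * 2) * 2)
                     ≡ suc (k * 2) * 2 * (suc (k * 2) * 2) / 2 + suc (k * 2) * 2
n*count-4k+2 k = begin
  n * count twoOnTwoOff n      ≡⟨ cong (n *_) (count-twoOnTwoOff-even (suc (k * 2))) ⟩
  n * (⌈ suc (k * 2) /2⌉ * 2)  ≡⟨ cong (λ c → n * (c * 2)) (⌈1+m*2/2⌉≡1+m k) ⟩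
  n * suc (suc (k * 2))        ≡⟨ *-suc n (suc (k * 2)) ⟩
  n + n * suc (k * 2)          ≡⟨ +-comm n _ ⟩
  n * suc (k * 2) + n          ≡⟨ cong (_+ n) (n*[m*2]/2≡n*m n (suc (k * 2))) ⟨
  n * n / 2 + n                ∎
  where
  open ≡-Reasoning
  n : ℕ
  n = suc (k * 2) * 2

proposition9 : (n : ℕ) → 3 ≤ n →
    ((n % 4 ≡ 0) → IsTDI n ((n * n) / 2))
    × ((n % 4 ≡ 1) ⊎ (n % 4 ≡ 3) → IsTDI n ((n * (n + 1)) / 2))
    × ((n % 4 ≡ 2) → IsTDI n ((n * n) / 2 + n))
proposition9 n 3≤n = case-0 , case-odd , case-2
  where
  instance
    n≢0 : NonZero n
    n≢0 = >-nonZero (≤-trans (s≤s z≤n) 3≤n)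

  k : ℕ
  k = n / 4

  residue : ∀ {r} → n % 4 ≡ r → n ≡ r + k * 2 * 2
  residue n%4≡r = trans (m≡m%n+[m/n]*n n 4) (cong₂ _+_ n%4≡r (sym (*-assoc k 2 2)))

  from-value : ∀ {x} (F : ℕ → ℕ) → n ≡ x → x * count twoOnTwoOff x ≡ F x → IsTDI n (F n)
  from-value F refl n*count≡F = subst (IsTDI n) n*count≡F (isTDI-cycle n)

  case-0 : n % 4 ≡ 0 → IsTDI n ((n * n) / 2)
  case-0 h = from-value (λ x → x * x / 2) (residue h) (n*count-4k k)

  case-odd : (n % 4 ≡ 1) ⊎ (n % 4 ≡ 3) → IsTDI n ((n * (n + 1)) / 2)
  case-odd (inj₁ h) = from-value (λ x → x * (x + 1) / 2) (residue h) (n*count-odd (k * 2))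
  case-odd (inj₂ h) = from-value (λ x → x * (x + 1) / 2) (residue h) (n*count-odd (suc (k * 2)))

  case-2 : n % 4 ≡ 2 → IsTDI n ((n * n) / 2 + n)
  case-2 h = from-value (λ x → x * x / 2 + x) (residue h) (n*count-4k+2 k)
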